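{- Let $n\geq 1$, $r\geq 0$ be integers and let $p$ be a prime with $(n+r)/2<p\leq n$. Then the $p$-adic Newton polygon of $L_n^{\langle r\rangle}(x)=\sum_{j=0}^{n}\binom{n-j+r}{n-j}\frac{x^j}{j!}$ has $-1/p$ as a slope. In particular, $p$ divides the Newton index of $L_n^{\langle r\rangle}(x)$.
   Context: For $g=\sum_{j=0}^n c_jx^j\in\mathbb{Q}[x]$ and a prime $p$, the $p$-adic Newton polygon $NP_p(g)$ is the lower convex hull of the points $\{(j,\mathrm{ord}_p(c_j)):0\leq j\leq n\}$, where $\mathrm{ord}_p$ is the $p$-adic valuation ($\mathrm{ord}_p(0)=\infty$). The Newton index of $g$ is the least common multiple of the denominators (in lowest terms, with $0$ having denominator $1$) of all slopes of $NP_p(g)$ as $p$ ranges over all primes. -}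

module Defs where

open import Data.Nat as ℕ using (ℕ; _^_; suc)
open import Data.Nat.Divisibility using (_∣_)
open import Data.Nat.Primality using (Prime)
open import Data.Nat.Combinatorics using (_C_)
open import Data.Nat.Properties using (_!≢0)
open import Data.Integer as ℤ using (ℤ; +_; ∣_∣)
open import Data.Rational as ℚ using (ℚ; ↥_; ↧ₙ_)
open import Data.Fin using (Fin; toℕ)
open import Data.List using (List; length; lookup; map; upTo)
open import Data.Product using (Σ; _×_)
open import Relation.Nullary using (¬_)
open import Relation.Binary.PropositionalEquality using (_≡_)

-- A polynomial g = Σ_j c_j x^j ∈ ℚ[x] is given by its coefficient list [c_0, …, c_n].
Poly : Set
Poly = List ℚ

ℤ→ℚ : ℤ → ℚ
ℤ→ℚ z = z ℚ./ 1

OrdN : ℕ → ℕ → ℕ → Set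
OrdN p m k = (p ^ k ∣ m) × ¬ (p ^ suc k ∣ m)

-- p-adic valuation of a nonzero rational q (in lowest terms a/b) is v = ord_p(a) - ord_p(b).
-- For q = 0 (ord = ∞) no finite v satisfies this relation.
Ordℚ : ℕ → ℚ → ℤ → Set
Ordℚ p q v = ¬ (↥ q ≡ + 0) × Σ ℕ λ a → Σ ℕ λ b →
  OrdN p ∣ ↥ q ∣ a × OrdN p (↧ₙ q) b × v ≡ (+ a) ℤ.- (+ b)

-- s is a slope of the p-adic Newton polygon of g (lower convex hull of the points
-- (j, ord_p c_j)): there is an edge, i.e. two points (i, v_i), (k, v_k) with i < k
-- whose connecting line has slope s, and all points (j, v_j) lie on or above that line.
HasSlope : ℕ → Poly → ℚ → Set
HasSlope p g s =
  Σ (Fin (length g)) λ i → Σ (Fin (length g)) λ k →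
  Σ ℤ λ vi → Σ ℤ λ vk →
    (toℕ i ℕ.< toℕ k) ×
    Ordℚ p (lookup g i) vi × Ordℚ p (lookup g k) vk ×
    (s ℚ.* ℤ→ℚ ((+ toℕ k) ℤ.- (+ toℕ i)) ≡ ℤ→ℚ (vk ℤ.- vi)) ×
    (∀ (j : Fin (length g)) (vj : ℤ) → Ordℚ p (lookup g j) vj →
       ℤ→ℚ vi ℚ.+ s ℚ.* ℤ→ℚ ((+ toℕ j) ℤ.- (+ toℕ i)) ℚ.≤ ℤ→ℚ vj)

AllSlopeDenomsDivide : Poly → ℕ → Set
AllSlopeDenomsDivide g N = ∀ (q : ℕ) → Prime q → ∀ (s : ℚ) → HasSlope q g s → ↧ₙ s ∣ N

-- N is the Newton index of g: the least common multiple of those denominators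
-- (characterised by the universal property of the lcm).
IsNewtonIndex : Poly → ℕ → Set
IsNewtonIndex g N = AllSlopeDenomsDivide g N × (∀ M → AllSlopeDenomsDivide g M → N ∣ M)

L : ℕ → ℕ → Poly
L n r = map (λ j → (ℚ._/_ (+ ((n ℕ.∸ j ℕ.+ r) C (n ℕ.∸ j))) (j ℕ.!)) {{j !≢0}}) (upTo (suc n))

{-# OPTIONS --safe #-}

-- Write c_j = binom(n-j+r, n-j) / j! for the coefficients.  Because n + r < 2p, every
-- factorial m! with m ≤ n + r contains p at most once, and exactly once iff p ≤ m.  So
-- ord_p c_0 = 0 (the single p in (n+r)! is the one in n!, as p ≤ n), ord_p c_p = -1 (the
-- numerator divides (n-p+r)! with n-p+r < p), and in general ord_p c_j ≥ -ord_p(j!), which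
-- is 0 for j < p and -1 ≥ -j/p otherwise.  Hence all points lie on or above the
-- segment from (0,0) to (p,-1), an edge of slope -1/p, whose denominator p must divide
-- the Newton index.

module Submission where

open import Defs
open import Data.Nat using (ℕ; _+_; _*_; _<_; _≤_)
open import Data.Nat.Divisibility using (_∣_)
open import Data.Nat.Primality using (Prime; prime⇒nonZero)
open import Data.Integer using (-[1+_])
open import Data.Rational using (_/_)
open import Data.Product using (_×_)

open import Data.Nat using (zero; suc; pred; _∸_; _^_; _!; z≤n; s≤s; s≤s⁻¹; z<s; NonZero; >-nonZero⁻¹)
open import Data.Nat.Properties
open import Data.Nat.Divisibility
  using (module ∣-Reasoning; divides; ∣-trans; _∣0; 1∣_; ∣1⇒≡1; >⇒∤; m∣m*n; *-monoʳ-∣; *-monoˡ-∣; *-pres-∣; *-cancelˡ-∣; m≤n⇒m!∣n!)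
open import Data.Nat.Primality using (euclidsLemma; ¬prime[1])
open import Data.Nat.Combinatorics using (_C_; nCk≡n!/k![n-k]!; k![n∸k]!∣n!)
open import Data.Nat.DivMod as ℕ using (m/n*n≡m)
open import Data.Nat.GCD using (gcd; gcd[m,n]∣m; gcd-zeroˡ)
open import Data.Integer as ℤ using (ℤ; +_; ∣_∣)
import Data.Integer.Properties as ℤ
open import Data.Rational as ℚ using (ℚ; ↥_; ↧_; ↧ₙ_; toℚᵘ)
import Data.Rational.Properties as ℚ
open import Data.Rational.Unnormalised as ℚᵘ using (mkℚᵘ; *≡*; *≤*)
import Data.Rational.Unnormalised.Properties as ℚᵘ
open import Data.Fin using (Fin; toℕ; fromℕ<)
open import Data.Fin.Properties using (toℕ<n; toℕ-fromℕ<)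
open import Data.List using (length; lookup; applyUpTo)
open import Data.List.Properties using (length-applyUpTo; lookup-applyUpTo; map-upTo)
open import Data.Product using (_,_; proj₁)
open import Data.Sum using (inj₁; inj₂)
open import Data.Empty using (⊥-elim)
open import Relation.Nullary using (¬_; contradiction)
open import Relation.Binary using (tri<; tri≈; tri>)
open import Relation.Binary.PropositionalEquality
  using (_≡_; refl; sym; trans; cong; cong₂; subst; module ≡-Reasoning)

private variable
  a b d k m n p : ℕ

p<m<2p⇒p∤m : p < m → m < 2 * p → ¬ p ∣ m
p<m<2p⇒p∤m p<0 _ (divides zero refl) = contradiction p<0 λ ()
p<m<2p⇒p∤m {p} p<p _ (divides 1 refl) = <-irrefl (sym (*-identityˡ p)) p<p
p<m<2p⇒p∤m {p} _ m<2p (divides (suc (suc q)) refl) = <⇒≱ m<2p (*-monoˡ-≤ p (s≤s (s≤s (z≤n {q}))))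

prime∤1 : Prime p → ¬ p ∣ 1
prime∤1 pp p∣1 = ¬prime[1] (subst Prime (∣1⇒≡1 p∣1) pp)

p∤m∧pᵏ∣m*n⇒pᵏ∣n : Prime p → ¬ p ∣ m → ∀ k → p ^ k ∣ m * n → p ^ k ∣ n
p∤m∧pᵏ∣m*n⇒pᵏ∣n _ _ zero _ = 1∣ _
p∤m∧pᵏ∣m*n⇒pᵏ∣n {p} {m} {n} pp p∤m (suc k) pᵏ⁺¹∣mn
  with euclidsLemma m n pp (∣-trans (m∣m*n (p ^ k)) pᵏ⁺¹∣mn)
... | inj₁ p∣m = contradiction p∣m p∤m
... | inj₂ (divides q refl) =
  subst (_∣ q * p) (*-comm (p ^ k) p) (*-monoˡ-∣ p (p∤m∧pᵏ∣m*n⇒pᵏ∣n pp p∤m k pᵏ∣mq))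
  where
  mqp≡pmq : m * (q * p) ≡ p * (m * q)
  mqp≡pmq = trans (sym (*-assoc m q p)) (*-comm (m * q) p)
  pᵏ∣mq : p ^ k ∣ m * q
  pᵏ∣mq = *-cancelˡ-∣ p {{prime⇒nonZero pp}} (subst (p * p ^ k ∣_) mqp≡pmq pᵏ⁺¹∣mn)

m<p⇒p∤m! : Prime p → m < p → ¬ p ∣ m !
m<p⇒p∤m! {m = zero} pp _ = prime∤1 pp
m<p⇒p∤m! {p} {suc m} pp 1+m<p p∣[1+m]! with euclidsLemma (suc m) (m !) pp p∣[1+m]!
... | inj₁ p∣1+m = >⇒∤ 1+m<p p∣1+m
... | inj₂ p∣m! = m<p⇒p∤m! pp (<-trans (n<1+n m) 1+m<p) p∣m!

m<2p⇒p²∤m! : Prime p → m < 2 * p → ¬ p ^ 2 ∣ m !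
m<2p⇒p²∤m! {m = zero} pp _ p²∣1 = prime∤1 pp (∣-trans (m∣m*n _) p²∣1)
m<2p⇒p²∤m! {p} {suc m} pp 1+m<2p p²∣[1+m]! with <-cmp (suc m) p
... | tri< 1+m<p _ _ = m<p⇒p∤m! pp 1+m<p (∣-trans (m∣m*n (p ^ 1)) p²∣[1+m]!)
... | tri≈ _ refl _ = m<p⇒p∤m! pp ≤-refl (∣-trans (m∣m*n 1) (*-cancelˡ-∣ (suc m) p²∣[1+m]!))
... | tri> _ _ p<1+m = m<2p⇒p²∤m! pp (<-trans (n<1+n m) 1+m<2p)
  (p∤m∧pᵏ∣m*n⇒pᵏ∣n pp (p<m<2p⇒p∤m p<1+m 1+m<2p) 2 p²∣[1+m]!)

pᵇ∣m!⇒b*p≤m : Prime p → m < 2 * p → p ^ b ∣ m ! → b * p ≤ m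
pᵇ∣m!⇒b*p≤m {b = zero} _ _ _ = z≤n
pᵇ∣m!⇒b*p≤m {p} {m} {b = 1} pp _ p¹∣m! = subst (_≤ m) (sym (*-identityˡ p))
  (≮⇒≥ λ m<p → m<p⇒p∤m! pp m<p (∣-trans (m∣m*n 1) p¹∣m!))
pᵇ∣m!⇒b*p≤m {p} {b = suc (suc b)} pp m<2p pᵇ∣m! =
  ⊥-elim (m<2p⇒p²∤m! pp m<2p (∣-trans (*-monoʳ-∣ p (*-monoʳ-∣ p (1∣ (p ^ b)))) pᵇ∣m!))

ordN-0 : ¬ p ∣ m → OrdN p m 0
ordN-0 {m = m} p∤m = 1∣ m , λ p¹∣m → p∤m (∣-trans (m∣m*n 1) p¹∣m)

ordN-p! : Prime p → OrdN p (p !) 1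
ordN-p! {zero} ()
ordN-p! {suc p} pp = *-monoʳ-∣ (suc p) (1∣ (p !)) , m<2p⇒p²∤m! pp (m<m+n (suc p) z<s)

nCk*[k!*[n∸k]!]≡n! : k ≤ n → (n C k) * (k ! * (n ∸ k) !) ≡ n !
nCk*[k!*[n∸k]!]≡n! {k} {n} k≤n = begin
  (n C k) * (k ! * (n ∸ k) !)                    ≡⟨ cong (_* (k ! * (n ∸ k) !)) (nCk≡n!/k![n-k]! k≤n) ⟩
  n ! ℕ./ (k ! * (n ∸ k) !) * (k ! * (n ∸ k) !)  ≡⟨ m/n*n≡m (k![n∸k]!∣n! k≤n) ⟩
  n !                                            ∎
  where
  open ≡-Reasoning
  instance _ = k !* (n ∸ k) !≢0

nCk∣n! : k ≤ n → n C k ∣ n !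
nCk∣n! {k} {n} k≤n = subst (n C k ∣_) (nCk*[k!*[n∸k]!]≡n! k≤n) (m∣m*n (k ! * (n ∸ k) !))

n<p⇒p∤nCk : Prime p → k ≤ n → n < p → ¬ p ∣ n C k
n<p⇒p∤nCk pp k≤n n<p p∣nCk = m<p⇒p∤m! pp n<p (∣-trans p∣nCk (nCk∣n! k≤n))

p≤k∧n<2p⇒p∤nCk : Prime p → p ≤ k → k ≤ n → n < 2 * p → ¬ p ∣ n C k
p≤k∧n<2p⇒p∤nCk {p} {k} {n} pp p≤k k≤n n<2p p∣nCk = m<2p⇒p²∤m! pp n<2p (begin
  p * p ^ 1                    ∣⟨ *-pres-∣ p∣nCk (∣-trans (proj₁ (ordN-p! pp)) (m≤n⇒m!∣n! p≤k)) ⟩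
  (n C k) * k !                ∣⟨ *-monoʳ-∣ (n C k) (m∣m*n ((n ∸ k) !)) ⟩
  (n C k) * (k ! * (n ∸ k) !)  ≡⟨ nCk*[k!*[n∸k]!]≡n! k≤n ⟩
  n !                          ∎)
  where open ∣-Reasoning

∣↥[i/d]∣*gcd≡∣i∣ : ∀ i d .{{_ : NonZero d}} → ∣ ↥ (i / d) ∣ * gcd ∣ i ∣ d ≡ ∣ i ∣
∣↥[i/d]∣*gcd≡∣i∣ i d = trans (sym (ℤ.abs-* (↥ (i / d)) (+ gcd ∣ i ∣ d))) (cong ∣_∣ (ℚ.↥-/ i d))

↧ₙ[i/d]*gcd≡d : ∀ i d .{{_ : NonZero d}} → ↧ₙ (i / d) * gcd ∣ i ∣ d ≡ d
↧ₙ[i/d]*gcd≡d i d = trans (sym (ℤ.abs-* (↧ (i / d)) (+ gcd ∣ i ∣ d))) (cong ∣_∣ (ℚ.↧-/ i d))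

↧ₙ[i/d]∣d : ∀ i d .{{_ : NonZero d}} → ↧ₙ (i / d) ∣ d
↧ₙ[i/d]∣d i d = subst (↧ₙ (i / d) ∣_) (↧ₙ[i/d]*gcd≡d i d) (m∣m*n (gcd ∣ i ∣ d))

↧ₙ[-1/d]≡d : ∀ d .{{_ : NonZero d}} → ↧ₙ (-[1+ 0 ] / d) ≡ d
↧ₙ[-1/d]≡d d = begin
  ↧ₙ (-[1+ 0 ] / d)               ≡⟨ *-identityʳ _ ⟨
  ↧ₙ (-[1+ 0 ] / d) * 1           ≡⟨ cong (↧ₙ (-[1+ 0 ] / d) *_) (gcd-zeroˡ d) ⟨
  ↧ₙ (-[1+ 0 ] / d) * gcd 1 d     ≡⟨ ↧ₙ[i/d]*gcd≡d -[1+ 0 ] d ⟩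
  d                               ∎
  where open ≡-Reasoning

-- The reduced form of a/d divides numerator and denominator by gcd a d, which is prime to p.
Ordℚ-/ : Prime p → ¬ p ∣ a → .{{_ : NonZero d}} → OrdN p d k → Ordℚ p (+ a / d) (+ 0 ℤ.- + k)
Ordℚ-/ {p} {a} {d} {k} pp p∤a (pᵏ∣d , pᵏ⁺¹∤d) = ↥≢0 , 0 , k , ordN-0 p∤↥ , (pᵏ∣↧ , pᵏ⁺¹∤↧) , refl
  where
  q = + a / d
  ∣↥∣∣a : ∣ ↥ q ∣ ∣ a
  ∣↥∣∣a = subst (∣ ↥ q ∣ ∣_) (∣↥[i/d]∣*gcd≡∣i∣ (+ a) d) (m∣m*n (gcd a d))
  p∤↥ : ¬ p ∣ ∣ ↥ q ∣
  p∤↥ p∣↥ = p∤a (∣-trans p∣↥ ∣↥∣∣a)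
  ↥≢0 : ¬ ↥ q ≡ + 0
  ↥≢0 ↥≡0 = p∤a (subst (p ∣_) 0≡a (p ∣0))
    where
    0≡a : 0 ≡ a
    0≡a = trans (cong (λ z → ∣ z ∣ * gcd a d) (sym ↥≡0)) (∣↥[i/d]∣*gcd≡∣i∣ (+ a) d)
  p∤gcd : ¬ p ∣ gcd a d
  p∤gcd p∣g = p∤a (∣-trans p∣g (gcd[m,n]∣m a d))
  pᵏ∣↧ : p ^ k ∣ ↧ₙ q
  pᵏ∣↧ = p∤m∧pᵏ∣m*n⇒pᵏ∣n pp p∤gcd k
    (subst (p ^ k ∣_) (trans (sym (↧ₙ[i/d]*gcd≡d (+ a) d)) (*-comm (↧ₙ q) (gcd a d))) pᵏ∣d)
  pᵏ⁺¹∤↧ : ¬ p ^ suc k ∣ ↧ₙ q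
  pᵏ⁺¹∤↧ pᵏ⁺¹∣↧ = pᵏ⁺¹∤d (∣-trans pᵏ⁺¹∣↧ (↧ₙ[i/d]∣d (+ a) d))

b*p≤m⇒-m≤[a-b]*p : ∀ a → b * p ≤ m → ℤ.- + m ℤ.≤ (+ a ℤ.- + b) ℤ.* + p
b*p≤m⇒-m≤[a-b]*p {b} {p} {m} a b*p≤m = begin
  ℤ.- + m                              ≤⟨ ℤ.neg-mono-≤ (ℤ.+≤+ b*p≤m) ⟩
  ℤ.- + (b * p)                        ≤⟨ ℤ.i≤j+i _ (+ (a * p)) ⟩
  + (a * p) ℤ.+ ℤ.- + (b * p)          ≡⟨ cong₂ (λ x y → x ℤ.+ ℤ.- y) (ℤ.pos-* a p) (ℤ.pos-* b p) ⟩
  + a ℤ.* + p ℤ.+ ℤ.- (+ b ℤ.* + p)    ≡⟨ cong (ℤ._+_ (+ a ℤ.* + p)) (ℤ.neg-distribˡ-* (+ b) (+ p)) ⟩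
  + a ℤ.* + p ℤ.+ ℤ.- + b ℤ.* + p      ≡⟨ ℤ.*-distribʳ-+ (+ p) (+ a) (ℤ.- + b) ⟨
  (+ a ℤ.- + b) ℤ.* + p                ∎
  where open ℤ.≤-Reasoning

Ordℚ[a/m!]⇒-m≤v*p : ∀ a {v} → Prime p → m < 2 * p → Ordℚ p ((+ a / m !) {{m !≢0}}) v → ℤ.- + m ℤ.≤ v ℤ.* + p
Ordℚ[a/m!]⇒-m≤v*p {p} {m} a pp m<2p (_ , a′ , b , _ , (pᵇ∣↧ , _) , refl) =
  b*p≤m⇒-m≤[a-b]*p {b} a′ (pᵇ∣m!⇒b*p≤m {b = b} pp m<2p (∣-trans pᵇ∣↧ (↧ₙ[i/d]∣d (+ a) (m !) {{m !≢0}})))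

toℚᵘ-/ : ∀ i d .{{_ : NonZero d}} → toℚᵘ (i / d) ℚᵘ.≃ mkℚᵘ i (pred d)
toℚᵘ-/ i (suc d) = ℚ.toℚᵘ-fromℚᵘ (mkℚᵘ i d)

/-*-ℤ→ℚ : ∀ i j d .{{_ : NonZero d}} → (i / d) ℚ.* ℤ→ℚ j ≡ (i ℤ.* j) / d
/-*-ℤ→ℚ i j d@(suc d-1) = ℚ.toℚᵘ-injective (begin-equality
  toℚᵘ ((i / d) ℚ.* ℤ→ℚ j)           ≃⟨ ℚ.toℚᵘ-homo-* (i / d) (ℤ→ℚ j) ⟩
  toℚᵘ (i / d) ℚᵘ.* toℚᵘ (ℤ→ℚ j)     ≃⟨ ℚᵘ.*-cong (toℚᵘ-/ i d) (toℚᵘ-/ j 1) ⟩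
  mkℚᵘ i d-1 ℚᵘ.* mkℚᵘ j 0            ≃⟨ *≡* (cong ((i ℤ.* j) ℤ.*_) (cong +_ (*-identityʳ d))) ⟨
  mkℚᵘ (i ℤ.* j) d-1                  ≃⟨ toℚᵘ-/ (i ℤ.* j) d ⟨
  toℚᵘ ((i ℤ.* j) / d)                ∎)
  where open ℚᵘ.≤-Reasoning

[i*d]/d≡ℤ→ℚi : ∀ i d .{{_ : NonZero d}} → (i ℤ.* + d) / d ≡ ℤ→ℚ i
[i*d]/d≡ℤ→ℚi i d@(suc d-1) = ℚ.fromℚᵘ-cong {mkℚᵘ (i ℤ.* + d) d-1} {mkℚᵘ i 0} (*≡* (ℤ.*-identityʳ _))

i≤j*d⇒i/d≤ℤ→ℚj : ∀ {i j} d .{{_ : NonZero d}} → i ℤ.≤ j ℤ.* + d → i / d ℚ.≤ ℤ→ℚ j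
i≤j*d⇒i/d≤ℤ→ℚj {i} {j} d@(suc d-1) i≤jd = ℚ.toℚᵘ-cancel-≤ (begin
  toℚᵘ (i / d)     ≃⟨ toℚᵘ-/ i d ⟩
  mkℚᵘ i d-1       ≤⟨ *≤* (ℤ.≤-trans (ℤ.≤-reflexive (ℤ.*-identityʳ i)) i≤jd) ⟩
  mkℚᵘ j 0         ≃⟨ toℚᵘ-/ j 1 ⟨
  toℚᵘ (ℤ→ℚ j)     ∎)
  where open ℚᵘ.≤-Reasoning

hasSlope-applyUpTo-at : ∀ (c : ℕ → ℚ) (s : ℚ) (i′ k′ : Fin (length (applyUpTo c m))) {i k vi vk} →
  toℕ i′ ≡ i → toℕ k′ ≡ k → i < k →
  Ordℚ p (c i) vi → Ordℚ p (c k) vk →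
  s ℚ.* ℤ→ℚ (+ k ℤ.- + i) ≡ ℤ→ℚ (vk ℤ.- vi) →
  (∀ j vj → j < m → Ordℚ p (c j) vj → ℤ→ℚ vi ℚ.+ s ℚ.* ℤ→ℚ (+ j ℤ.- + i) ℚ.≤ ℤ→ℚ vj) →
  HasSlope p (applyUpTo c m) s
hasSlope-applyUpTo-at {m} {p} c s i′ k′ {vi = vi} {vk} refl refl i<k ordᵢ ordₖ slope below =
  i′ , k′ , vi , vk , i<k , atIndex i′ ordᵢ , atIndex k′ ordₖ , slope ,
  λ j vj ordⱼ → below (toℕ j) vj (subst (toℕ j <_) (length-applyUpTo c m) (toℕ<n j)) (fromIndex j ordⱼ)
  where
  atIndex : ∀ {v} j → Ordℚ p (c (toℕ j)) v → Ordℚ p (lookup (applyUpTo c m) j) v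
  atIndex {v} j = subst (λ x → Ordℚ p x v) (sym (lookup-applyUpTo c m j))
  fromIndex : ∀ {v} j → Ordℚ p (lookup (applyUpTo c m) j) v → Ordℚ p (c (toℕ j)) v
  fromIndex {v} j = subst (λ x → Ordℚ p x v) (lookup-applyUpTo c m j)

hasSlope-applyUpTo : ∀ (c : ℕ → ℚ) (s : ℚ) {i k vi vk} → i < k → k < m →
  Ordℚ p (c i) vi → Ordℚ p (c k) vk →
  s ℚ.* ℤ→ℚ (+ k ℤ.- + i) ≡ ℤ→ℚ (vk ℤ.- vi) →
  (∀ j vj → j < m → Ordℚ p (c j) vj → ℤ→ℚ vi ℚ.+ s ℚ.* ℤ→ℚ (+ j ℤ.- + i) ℚ.≤ ℤ→ℚ vj) →
  HasSlope p (applyUpTo c m) s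
hasSlope-applyUpTo {m} c s i<k k<m =
  hasSlope-applyUpTo-at c s (fromℕ< i<ℓ) (fromℕ< k<ℓ) (toℕ-fromℕ< i<ℓ) (toℕ-fromℕ< k<ℓ) i<k
  where
  i<ℓ = subst (_ <_) (sym (length-applyUpTo c m)) (<-trans i<k k<m)
  k<ℓ = subst (_ <_) (sym (length-applyUpTo c m)) k<m

L-coeff : ℕ → ℕ → ℕ → ℚ
L-coeff n r j = (+ ((n ∸ j + r) C (n ∸ j)) / j !) {{j !≢0}}

L-hasSlope-[-1/p] : ∀ {n r} (pp : Prime p) → n + r < 2 * p → p ≤ n →
  HasSlope p (L n r) ((-[1+ 0 ] / p) {{prime⇒nonZero pp}})
L-hasSlope-[-1/p] {p} {n} {r} pp n+r<2p p≤n =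
  subst (λ g → HasSlope p g s) (sym (map-upTo (L-coeff n r) (suc n)))
    (hasSlope-applyUpTo (L-coeff n r) s (>-nonZero⁻¹ p) (s≤s p≤n) ord₀ ordₚ slope below)
  where
  instance _ = prime⇒nonZero pp
  s = -[1+ 0 ] / p
  n∸p+r<p : n ∸ p + r < p
  n∸p+r<p = subst (_< p) (+-∸-comm r p≤n) (m<n+o⇒m∸n<o (n + r) p n+r<p+p)
    where
    n+r<p+p : n + r < p + p
    n+r<p+p = subst (n + r <_) (cong (_+_ p) (+-identityʳ p)) n+r<2p
  ord₀ : Ordℚ p (L-coeff n r 0) (+ 0)
  ord₀ = Ordℚ-/ {k = 0} pp (p≤k∧n<2p⇒p∤nCk pp p≤n (m≤m+n n r) n+r<2p) (ordN-0 (prime∤1 pp))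
  ordₚ : Ordℚ p (L-coeff n r p) (+ 0 ℤ.- + 1)
  ordₚ = Ordℚ-/ pp (n<p⇒p∤nCk pp (m≤m+n (n ∸ p) r) n∸p+r<p) {{p !≢0}} (ordN-p! pp)
  slope : s ℚ.* ℤ→ℚ (+ p ℤ.- + 0) ≡ ℤ→ℚ ((+ 0 ℤ.- + 1) ℤ.- + 0)
  slope = begin
    s ℚ.* ℤ→ℚ (+ p ℤ.- + 0)   ≡⟨ cong (λ x → s ℚ.* ℤ→ℚ x) (ℤ.+-identityʳ (+ p)) ⟩
    s ℚ.* ℤ→ℚ (+ p)           ≡⟨ /-*-ℤ→ℚ -[1+ 0 ] (+ p) p ⟩
    (-[1+ 0 ] ℤ.* + p) / p    ≡⟨ [i*d]/d≡ℤ→ℚi -[1+ 0 ] p ⟩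
    ℤ→ℚ -[1+ 0 ]              ∎
    where open ≡-Reasoning
  below : ∀ j vj → j < suc n → Ordℚ p (L-coeff n r j) vj →
    ℤ→ℚ (+ 0) ℚ.+ s ℚ.* ℤ→ℚ (+ j ℤ.- + 0) ℚ.≤ ℤ→ℚ vj
  below j vj j<1+n ordⱼ = begin
    ℤ→ℚ (+ 0) ℚ.+ s ℚ.* ℤ→ℚ (+ j ℤ.- + 0)  ≡⟨ ℚ.+-identityˡ _ ⟩
    s ℚ.* ℤ→ℚ (+ j ℤ.- + 0)                ≡⟨ /-*-ℤ→ℚ -[1+ 0 ] (+ j ℤ.- + 0) p ⟩
    (-[1+ 0 ] ℤ.* (+ j ℤ.- + 0)) / p       ≡⟨ cong (_/ p) (trans (ℤ.-1*i≡-i _) (cong ℤ.-_ (ℤ.+-identityʳ (+ j)))) ⟩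
    (ℤ.- + j) / p                           ≤⟨ i≤j*d⇒i/d≤ℤ→ℚj {j = vj} p -j≤vj*p ⟩
    ℤ→ℚ vj                                  ∎
    where
    open ℚ.≤-Reasoning
    j<2p : j < 2 * p
    j<2p = ≤-<-trans (≤-trans (s≤s⁻¹ j<1+n) (m≤m+n n r)) n+r<2p
    -j≤vj*p : ℤ.- + j ℤ.≤ vj ℤ.* + p
    -j≤vj*p = Ordℚ[a/m!]⇒-m≤v*p ((n ∸ j + r) C (n ∸ j)) pp j<2p ordⱼ

lemma5p3 : (n r p : ℕ) → 1 ≤ n → (pp : Prime p) → n + r < 2 * p → p ≤ n →
    HasSlope p (L n r) ((-[1+ 0 ] / p) {{prime⇒nonZero pp}}) ×
    (∀ (N : ℕ) → IsNewtonIndex (L n r) N → p ∣ N)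
lemma5p3 n r p _ pp n+r<2p p≤n = hasSlope , λ N isIndex →
  subst (_∣ N) (↧ₙ[-1/d]≡d p) (proj₁ isIndex p pp (-[1+ 0 ] / p) hasSlope)
  where
  instance _ = prime⇒nonZero pp
  hasSlope = L-hasSlope-[-1/p] pp n+r<2p p≤n
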